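{- Let $m\ge 0$. There is an explicit bijection between the set $\mathcal{O}_{2m,0}$ of walks of length $2m$ starting at the origin, with steps in $\{(0,1),(0,-1),(1,0),(-1,0)\}$, staying in the region $\{(x,y): x\ge y\ge 0\}$, and ending on the diagonal $y=x$, and the set $\mathcal{D}_{2m}\times\mathcal{D}_{2(m+1)}$ of pairs of Dyck paths of lengths $2m$ and $2m+2$.
   Context: A Dyck path of length $2k$ is a lattice path from $(0,0)$ with $2k$ steps $U=(1,1)$ and $D=(1,-1)$ that never goes below the $x$-axis and ends on the $x$-axis. Walks may self-intersect. -}

module Defs where

open import Data.Nat using (ℕ; suc; _*_)
open import Data.Integer using (ℤ; +_; _+_; _-_; _≤_; 0ℤ; 1ℤ)
open import Data.Product using (Σ; _×_; _,_; proj₁; proj₂)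
open import Data.Unit using (⊤)
open import Data.Vec using (Vec; []; _∷_)
open import Relation.Binary.PropositionalEquality using (_≡_)

data Step : Set where
  N S E W : Step

Point : Set
Point = ℤ × ℤ

origin : Point
origin = (0ℤ , 0ℤ)

move : Point → Step → Point
move (x , y) N = (x , y + 1ℤ)
move (x , y) S = (x , y - 1ℤ)
move (x , y) E = (x + 1ℤ , y)
move (x , y) W = (x - 1ℤ , y)

InRegion : Point → Set
InRegion (x , y) = (y ≤ x) × (0ℤ ≤ y)

StaysInRegion : ∀ {n} → Point → Vec Step n → Set
StaysInRegion p []       = ⊤
StaysInRegion p (s ∷ w)  = InRegion (move p s) × StaysInRegion (move p s) w

endpoint : ∀ {n} → Point → Vec Step n → Point
endpoint p []      = p
endpoint p (s ∷ w) = endpoint (move p s) w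

OnDiagonal : Point → Set
OnDiagonal (x , y) = y ≡ x

𝒪 : ℕ → Set
𝒪 n = Σ (Vec Step n) λ w →
        StaysInRegion origin w × OnDiagonal (endpoint origin w)

data DStep : Set where
  U D : DStep

stepH : ℤ → DStep → ℤ
stepH h U = h + 1ℤ
stepH h D = h - 1ℤ

Nonneg : ∀ {n} → ℤ → Vec DStep n → Set
Nonneg h []      = ⊤
Nonneg h (s ∷ w) = (0ℤ ≤ stepH h s) × Nonneg (stepH h s) w

finalH : ∀ {n} → ℤ → Vec DStep n → ℤ
finalH h []      = h
finalH h (s ∷ w) = finalH (stepH h s) w

𝒟 : ℕ → Set
𝒟 n = Σ (Vec DStep n) λ w → Nonneg 0ℤ w × (finalH 0ℤ w ≡ 0ℤ)

-- In the coordinates u = x + y, v = x − y every step moves u and v by ±1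
-- independently, and the region becomes the Weyl chamber 0 ≤ v ≤ u.  By the
-- reflection principle the number of admissible walks of length n from (x , y)
-- is a 2 × 2 determinant H of counts of unrestricted ±1-walks: H satisfies the
-- four-term step recurrence, vanishes on the two walls just outside the region,
-- and has the right initial values.  At the origin, the ratio between
-- neighbouring binomial coefficients collapses H to (c₀ − c₂)(c₀ − c₄), where
-- c_z counts ±1-walks of length n from z to 0, and the ballot formula
-- identifies the two factors with the numbers of Dyck paths of lengths n and
-- n + 2.  Both sides being finite with the same cardinality, they are in
-- bijection.
module Submission where

open import Defs
open import Data.Nat using (ℕ; suc; _*_)
open import Data.Product using (_×_)
open import Function.Bundles using (_⤖_)

open import Axiom.UniquenessOfIdentityProofs using (module Decidable⇒UIP)
open import Data.Empty using (⊥-elim)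
open import Data.Fin using (Fin)
open import Data.Fin.Properties using (1↔⊤; +↔⊎; *↔×)
open import Data.Integer
  using (ℤ; +_; -[1+_]; 0ℤ; _+_; _-_; -_; _≤_; +≤+; _≤?_; _≟_)
  renaming (_*_ to _·_)
import Data.Integer.Properties as ℤₚ
open import Data.Integer.Tactic.RingSolver using (solve-∀)
open import Data.Nat as ℕ using (zero; z≤n; _∸_)
import Data.Nat.Properties as ℕₚ
open import Data.Product using (Σ; ∃-syntax; _,_; proj₂)
open import Data.Product.Function.NonDependent.Propositional using (_×-↔_)
open import Data.Sum using (_⊎_; inj₁; inj₂)
open import Data.Sum.Function.Propositional using (_⊎-↔_)
open import Data.Unit using (⊤; tt)
open import Data.Vec using (Vec; []; _∷_)
open import Function.Bundles using (_↔_; mk↔ₛ′)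
open import Function.Construct.Composition using (_↔-∘_)
open import Function.Construct.Symmetry using (↔-sym)
open import Function.Properties.Inverse using (↔-refl; ↔⇒⤖)
open import Function.Related.Propositional using (module EquationalReasoning)
open import Relation.Nullary using (Dec; yes; no; ¬_; contradiction)
open import Relation.Nullary.Decidable using (_×-dec_)
open import Relation.Nullary.Irrelevant using (Irrelevant)
open import Relation.Binary.PropositionalEquality
  using (_≡_; refl; sym; trans; cong; cong₂; subst; module ≡-Reasoning)

guard : {P : Set} → Dec P → ℕ → ℕ
guard (yes _) k = k
guard (no _)  _ = 0

guard-↔ : {P T : Set} (P? : Dec P) → Irrelevant P →
          ∀ {k} → T ↔ Fin k → (P × T) ↔ Fin (guard P? k)
guard-↔ (yes p) irr T↔Fin =
  T↔Fin ↔-∘ mk↔ₛ′ proj₂ (p ,_) (λ _ → refl) (λ (q , t) → cong (_, t) (irr p q))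
guard-↔ (no ¬p) _ _ =
  mk↔ₛ′ (λ (p , _) → contradiction p ¬p) (λ ()) (λ ()) (λ (p , _) → contradiction p ¬p)

+-guard-≡ : {P : Set} (P? : Dec P) {k : ℕ} {h : ℤ} →
            (P → + k ≡ h) → (¬ P → h ≡ 0ℤ) → + guard P? k ≡ h
+-guard-≡ (yes p) k≡h _   = k≡h p
+-guard-≡ (no ¬p) _   h≡0 = sym (h≡0 ¬p)

≡ℤ-irrelevant : {i j : ℤ} → Irrelevant (i ≡ j)
≡ℤ-irrelevant = Decidable⇒UIP.≡-irrelevant _≟_

+↔⊎₄ : ∀ {a b c d} → Fin (a ℕ.+ (b ℕ.+ (c ℕ.+ d))) ↔ (Fin a ⊎ (Fin b ⊎ (Fin c ⊎ Fin d)))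
+↔⊎₄ = (↔-refl ⊎-↔ ((↔-refl ⊎-↔ +↔⊎) ↔-∘ +↔⊎)) ↔-∘ +↔⊎

Walk : ℕ → Point → Set
Walk n p = Σ (Vec Step n) λ w → StaysInRegion p w × OnDiagonal (endpoint p w)

WalkVia : ℕ → Point → Step → Set
WalkVia n p s = InRegion (move p s) × Walk n (move p s)

Walk-zero-↔ : ∀ x y → Walk 0 (x , y) ↔ ((y ≡ x) × ⊤)
Walk-zero-↔ x y = mk↔ₛ′ (λ { ([] , tt , d) → d , tt }) (λ (d , tt) → [] , tt , d)
                        (λ _ → refl) (λ { ([] , tt , d) → refl })

Walk-suc-↔ : ∀ n p →
  Walk (suc n) p ↔ (WalkVia n p N ⊎ (WalkVia n p S ⊎ (WalkVia n p E ⊎ WalkVia n p W)))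
Walk-suc-↔ n p = mk↔ₛ′ split join split∘join join∘split
  where
  Via : Set
  Via = WalkVia n p N ⊎ (WalkVia n p S ⊎ (WalkVia n p E ⊎ WalkVia n p W))
  split : Walk (suc n) p → Via
  split (N ∷ w , (r , st) , d) = inj₁ (r , w , st , d)
  split (S ∷ w , (r , st) , d) = inj₂ (inj₁ (r , w , st , d))
  split (E ∷ w , (r , st) , d) = inj₂ (inj₂ (inj₁ (r , w , st , d)))
  split (W ∷ w , (r , st) , d) = inj₂ (inj₂ (inj₂ (r , w , st , d)))
  join : Via → Walk (suc n) p
  join (inj₁ (r , w , st , d))               = N ∷ w , (r , st) , d
  join (inj₂ (inj₁ (r , w , st , d)))        = S ∷ w , (r , st) , d
  join (inj₂ (inj₂ (inj₁ (r , w , st , d)))) = E ∷ w , (r , st) , d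
  join (inj₂ (inj₂ (inj₂ (r , w , st , d)))) = W ∷ w , (r , st) , d
  split∘join : ∀ v → split (join v) ≡ v
  split∘join (inj₁ _)               = refl
  split∘join (inj₂ (inj₁ _))        = refl
  split∘join (inj₂ (inj₂ (inj₁ _))) = refl
  split∘join (inj₂ (inj₂ (inj₂ _))) = refl
  join∘split : ∀ w → join (split w) ≡ w
  join∘split (N ∷ _ , _) = refl
  join∘split (S ∷ _ , _) = refl
  join∘split (E ∷ _ , _) = refl
  join∘split (W ∷ _ , _) = refl

region? : ∀ p → Dec (InRegion p)
region? (x , y) = (y ≤? x) ×-dec (0ℤ ≤? y)

region-irrelevant : ∀ p → Irrelevant (InRegion p)
region-irrelevant (x , y) (a , b) (a′ , b′) = cong₂ _,_ (ℤₚ.≤-irrelevant a a′) (ℤₚ.≤-irrelevant b b′)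

walkCount : ℕ → Point → ℕ
walkCount zero    (x , y) = guard (y ≟ x) 1
walkCount (suc n) p       = via N ℕ.+ (via S ℕ.+ (via E ℕ.+ via W))
  where via : Step → ℕ
        via s = guard (region? (move p s)) (walkCount n (move p s))

Walk↔Fin : ∀ n p → Walk n p ↔ Fin (walkCount n p)
Walk↔Fin zero    (x , y) = guard-↔ (y ≟ x) ≡ℤ-irrelevant (↔-sym 1↔⊤) ↔-∘ Walk-zero-↔ x y
Walk↔Fin (suc n) p       =
  ↔-sym +↔⊎₄ ↔-∘ ((via N ⊎-↔ (via S ⊎-↔ (via E ⊎-↔ via W))) ↔-∘ Walk-suc-↔ n p)
  where via : ∀ s → WalkVia n p s ↔ Fin (guard (region? (move p s)) (walkCount n (move p s)))
        via s = guard-↔ (region? (move p s)) (region-irrelevant (move p s)) (Walk↔Fin n (move p s))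

Dyck : ℕ → ℤ → Set
Dyck n h = Σ (Vec DStep n) λ w → Nonneg h w × (finalH h w ≡ 0ℤ)

DyckVia : ℕ → ℤ → DStep → Set
DyckVia n h s = (0ℤ ≤ stepH h s) × Dyck n (stepH h s)

Dyck-zero-↔ : ∀ h → Dyck 0 h ↔ ((h ≡ 0ℤ) × ⊤)
Dyck-zero-↔ h = mk↔ₛ′ (λ { ([] , tt , d) → d , tt }) (λ (d , tt) → [] , tt , d)
                      (λ _ → refl) (λ { ([] , tt , d) → refl })

Dyck-suc-↔ : ∀ n h → Dyck (suc n) h ↔ (DyckVia n h U ⊎ DyckVia n h D)
Dyck-suc-↔ n h = mk↔ₛ′ split join split∘join join∘split
  where
  split : Dyck (suc n) h → DyckVia n h U ⊎ DyckVia n h D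
  split (U ∷ w , (r , st) , d) = inj₁ (r , w , st , d)
  split (D ∷ w , (r , st) , d) = inj₂ (r , w , st , d)
  join : DyckVia n h U ⊎ DyckVia n h D → Dyck (suc n) h
  join (inj₁ (r , w , st , d)) = U ∷ w , (r , st) , d
  join (inj₂ (r , w , st , d)) = D ∷ w , (r , st) , d
  split∘join : ∀ v → split (join v) ≡ v
  split∘join (inj₁ _) = refl
  split∘join (inj₂ _) = refl
  join∘split : ∀ w → join (split w) ≡ w
  join∘split (U ∷ _ , _) = refl
  join∘split (D ∷ _ , _) = refl

dyckCount : ℕ → ℤ → ℕ
dyckCount zero    h = guard (h ≟ 0ℤ) 1
dyckCount (suc n) h = via U ℕ.+ via D
  where via : DStep → ℕ
        via s = guard (0ℤ ≤? stepH h s) (dyckCount n (stepH h s))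

Dyck↔Fin : ∀ n h → Dyck n h ↔ Fin (dyckCount n h)
Dyck↔Fin zero    h = guard-↔ (h ≟ 0ℤ) ≡ℤ-irrelevant (↔-sym 1↔⊤) ↔-∘ Dyck-zero-↔ h
Dyck↔Fin (suc n) h = ↔-sym +↔⊎ ↔-∘ ((via U ⊎-↔ via D) ↔-∘ Dyck-suc-↔ n h)
  where via : ∀ s → DyckVia n h s ↔ Fin (guard (0ℤ ≤? stepH h s) (dyckCount n (stepH h s)))
        via s = guard-↔ (0ℤ ≤? stepH h s) ℤₚ.≤-irrelevant (Dyck↔Fin n (stepH h s))

record IsPascal (F : ℕ → ℤ → ℤ) : Set where
  constructor isPascal
  field step : ∀ n z → F (suc n) z ≡ F n (z - + 1) + F n (z + + 1)
open IsPascal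

pascal : (ℤ → ℤ) → ℕ → ℤ → ℤ
pascal f zero      = f
pascal f (suc n) z = pascal f n (z - + 1) + pascal f n (z + + 1)

pascal-isPascal : ∀ f → IsPascal (pascal f)
pascal-isPascal f = isPascal λ _ _ → refl

module _ {F G : ℕ → ℤ → ℤ} (F↑ : IsPascal F) (G↑ : IsPascal G) where

  IsPascal-unique : (∀ z → F 0 z ≡ G 0 z) → ∀ n z → F n z ≡ G n z
  IsPascal-unique F₀≡G₀ zero    z = F₀≡G₀ z
  IsPascal-unique F₀≡G₀ (suc n) z = begin
    F (suc n) z                   ≡⟨ step F↑ n z ⟩
    F n (z - + 1) + F n (z + + 1) ≡⟨ cong₂ _+_ (IsPascal-unique F₀≡G₀ n _) (IsPascal-unique F₀≡G₀ n _) ⟩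
    G n (z - + 1) + G n (z + + 1) ≡⟨ step G↑ n z ⟨
    G (suc n) z                   ∎
    where open ≡-Reasoning

  IsPascal-+ : IsPascal (λ n z → F n z + G n z)
  IsPascal-+ = isPascal λ n z → trans (cong₂ _+_ (step F↑ n z) (step G↑ n z))
                         (interchange (F n (z - + 1)) (F n (z + + 1)) (G n (z - + 1)) (G n (z + + 1)))
    where interchange : ∀ a b c d → (a + b) + (c + d) ≡ (a + c) + (b + d)
          interchange = solve-∀

  IsPascal-− : IsPascal (λ n z → F n z - G n z)
  IsPascal-− = isPascal λ n z → trans (cong₂ _-_ (step F↑ n z) (step G↑ n z))
                         (interchange (F n (z - + 1)) (F n (z + + 1)) (G n (z - + 1)) (G n (z + + 1)))
    where interchange : ∀ a b c d → (a + b) - (c + d) ≡ (a - c) + (b - d)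
          interchange = solve-∀

module _ {F : ℕ → ℤ → ℤ} (F↑ : IsPascal F) (a : ℤ) where

  IsPascal-shift : IsPascal (λ n z → F n (z + a))
  IsPascal-shift = isPascal λ n z →
    trans (step F↑ n (z + a)) (cong₂ (λ u v → F n u + F n v) (shift₋ z a) (shift₊ z a))
    where shift₋ : ∀ z a → z + a - + 1 ≡ z - + 1 + a
          shift₋ = solve-∀
          shift₊ : ∀ z a → z + a + + 1 ≡ z + + 1 + a
          shift₊ = solve-∀

  IsPascal-reflect : IsPascal (λ n z → F n (a - z))
  IsPascal-reflect = isPascal λ n z → begin
    F (suc n) (a - z)                         ≡⟨ step F↑ n (a - z) ⟩
    F n (a - z - + 1) + F n (a - z + + 1)     ≡⟨ cong₂ (λ u v → F n u + F n v) (reflect₋ a z) (reflect₊ a z) ⟩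
    F n (a - (z + + 1)) + F n (a - (z - + 1)) ≡⟨ ℤₚ.+-comm (F n (a - (z + + 1))) _ ⟩
    F n (a - (z - + 1)) + F n (a - (z + + 1)) ∎
    where open ≡-Reasoning
          reflect₋ : ∀ a z → a - z - + 1 ≡ a - (z + + 1)
          reflect₋ = solve-∀
          reflect₊ : ∀ a z → a - z + + 1 ≡ a - (z - + 1)
          reflect₊ = solve-∀

det : (ℕ → ℤ → ℤ) → (ℕ → ℤ → ℤ) → ℕ → ℤ → ℤ → ℤ
det F G n s t = F n s · G n t - F n t · G n s

det-suc : ∀ {F G} → IsPascal F → IsPascal G → ∀ n s t →
  det F G (suc n) s t ≡
    (det F G n (s - + 1) (t - + 1) + det F G n (s - + 1) (t + + 1)) +
    (det F G n (s + + 1) (t - + 1) + det F G n (s + + 1) (t + + 1))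
det-suc {F} {G} F↑ G↑ n s t = begin
  F (suc n) s · G (suc n) t - F (suc n) t · G (suc n) s
    ≡⟨ cong₂ _-_ (cong₂ _·_ (step F↑ n s) (step G↑ n t)) (cong₂ _·_ (step F↑ n t) (step G↑ n s)) ⟩
  (F n (s - + 1) + F n (s + + 1)) · (G n (t - + 1) + G n (t + + 1)) -
  (F n (t - + 1) + F n (t + + 1)) · (G n (s - + 1) + G n (s + + 1))
    ≡⟨ expand (F n (s - + 1)) (F n (s + + 1)) (G n (s - + 1)) (G n (s + + 1))
              (F n (t - + 1)) (F n (t + + 1)) (G n (t - + 1)) (G n (t + + 1)) ⟩
  _ ∎
  where
  open ≡-Reasoning
  expand : ∀ a₁ a₂ b₁ b₂ p₁ p₂ q₁ q₂ →
    (a₁ + a₂) · (q₁ + q₂) - (p₁ + p₂) · (b₁ + b₂) ≡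
    ((a₁ · q₁ - p₁ · b₁) + (a₁ · q₂ - p₂ · b₁)) + ((a₂ · q₁ - p₁ · b₂) + (a₂ · q₂ - p₂ · b₂))
  expand = solve-∀

δ₀ : ℤ → ℤ
δ₀ (+ zero)  = + 1
δ₀ (+ suc _) = 0ℤ
δ₀ -[1+ _ ]  = 0ℤ

isOdd : ℕ → ℤ
isOdd zero          = 0ℤ
isOdd (suc zero)    = + 1
isOdd (suc (suc k)) = isOdd k

evenNonpos : ℤ → ℤ
evenNonpos (+ zero)  = + 1
evenNonpos (+ suc _) = 0ℤ
evenNonpos -[1+ k ]  = isOdd k

-- paths n z counts the ±1-walks of length n from z to 0, and pathsTail n z
-- those from z to an even non-positive height
paths pathsTail : ℕ → ℤ → ℤ
paths     = pascal δ₀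
pathsTail = pascal evenNonpos

paths-reflect : ∀ n z → paths n (0ℤ - z) ≡ paths n z
paths-reflect = IsPascal-unique (IsPascal-reflect (pascal-isPascal δ₀) 0ℤ) (pascal-isPascal δ₀) δ₀-reflect
  where δ₀-reflect : ∀ z → δ₀ (0ℤ - z) ≡ δ₀ z
        δ₀-reflect (+ zero)  = refl
        δ₀-reflect (+ suc _) = refl
        δ₀-reflect -[1+ _ ]  = refl

pathsTail-unfold : ∀ n z → pathsTail n z ≡ paths n z + pathsTail n (z + + 2)
pathsTail-unfold = IsPascal-unique (pascal-isPascal evenNonpos)
  (IsPascal-+ (pascal-isPascal δ₀) (IsPascal-shift (pascal-isPascal evenNonpos) (+ 2)))
  evenNonpos-unfold
  where evenNonpos-unfold : ∀ z → evenNonpos z ≡ δ₀ z + evenNonpos (z + + 2)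
        evenNonpos-unfold (+ zero)              = refl
        evenNonpos-unfold (+ suc _)             = refl
        evenNonpos-unfold -[1+ 0 ]              = refl
        evenNonpos-unfold -[1+ 1 ]              = refl
        evenNonpos-unfold -[1+ suc (suc k) ]    = sym (ℤₚ.+-identityˡ (isOdd k))

evenNonpos-double : ∀ k → evenNonpos (- + (k ℕ.+ k)) ≡ + 1
evenNonpos-double zero    = refl
evenNonpos-double (suc k) rewrite ℕₚ.+-suc k k = isOdd-1+2k k
  where isOdd-1+2k : ∀ k → isOdd (suc (k ℕ.+ k)) ≡ + 1
        isOdd-1+2k zero    = refl
        isOdd-1+2k (suc k) rewrite ℕₚ.+-suc k k = isOdd-1+2k k

ratio-step : ∀ m j {a b d} →
  (m - (j - + 1)) · a ≡ (m + (j - + 1) + + 2) · b →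
  (m - (j + + 1)) · b ≡ (m + (j + + 1) + + 2) · d →
  (+ 1 + m - j) · (a + b) ≡ (+ 1 + m + j + + 2) · (b + d)
ratio-step m j {a} {b} {d} rel₁ rel₂ = ℤₚ.i-j≡0⇒i≡j _ _ (begin
  (+ 1 + m - j) · (a + b) - (+ 1 + m + j + + 2) · (b + d)
    ≡⟨ split m j a b d ⟩
  ((m - (j - + 1)) · a - (m + (j - + 1) + + 2) · b) + ((m - (j + + 1)) · b - (m + (j + + 1) + + 2) · d)
    ≡⟨ cong₂ _+_ (ℤₚ.i≡j⇒i-j≡0 rel₁) (ℤₚ.i≡j⇒i-j≡0 rel₂) ⟩
  0ℤ ∎)
  where
  open ≡-Reasoning
  split : ∀ m j a b d →
    (+ 1 + m - j) · (a + b) - (+ 1 + m + j + + 2) · (b + d) ≡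
    ((m - (j - + 1)) · a - (m + (j - + 1) + + 2) · b) + ((m - (j + + 1)) · b - (m + (j + + 1) + + 2) · d)
  split = solve-∀

-- paths n j is the binomial coefficient C(n, (n − j)/2); this is the ratio of two neighbouring ones
paths-ratio : ∀ n j → (+ n - j) · paths n j ≡ (+ n + j + + 2) · paths n (j + + 2)
paths-ratio zero j = δ₀-ratio j
  where δ₀-ratio : ∀ j → (+ 0 - j) · δ₀ j ≡ (+ 0 + j + + 2) · δ₀ (j + + 2)
        δ₀-ratio (+ zero)              = refl
        δ₀-ratio (+ suc k)             = trans (ℤₚ.*-zeroʳ (+ 0 - + suc k)) (sym (ℤₚ.*-zeroʳ (+ 0 + + suc k + + 2)))
        δ₀-ratio -[1+ 0 ]              = refl
        δ₀-ratio -[1+ 1 ]              = refl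
        δ₀-ratio j@(-[1+ suc (suc k) ]) = trans (ℤₚ.*-zeroʳ (+ 0 - j)) (sym (ℤₚ.*-zeroʳ (+ 0 + j + + 2)))
paths-ratio (suc n) j = begin
  (+ 1 + + n - j) · (c (j - + 1) + c (j + + 1))
    ≡⟨ ratio-step (+ n) j rel₁ (paths-ratio n (j + + 1)) ⟩
  κ · (c (j + + 1) + c (j + + 1 + + 2))
    ≡⟨ cong₂ (λ u v → κ · (c u + c v)) (j+2-1≡j+1 j) (j+2+1≡j+1+2 j) ⟨
  κ · paths (suc n) (j + + 2) ∎
  where
  open ≡-Reasoning
  c : ℤ → ℤ
  c = paths n
  κ : ℤ
  κ = + 1 + + n + j + + 2
  j-1+2≡j+1 : ∀ j → j - + 1 + + 2 ≡ j + + 1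
  j-1+2≡j+1 = solve-∀
  j+2-1≡j+1 : ∀ j → j + + 2 - + 1 ≡ j + + 1
  j+2-1≡j+1 = solve-∀
  j+2+1≡j+1+2 : ∀ j → j + + 2 + + 1 ≡ j + + 1 + + 2
  j+2+1≡j+1+2 = solve-∀
  rel₁ : (+ n - (j - + 1)) · c (j - + 1) ≡ (+ n + (j - + 1) + + 2) · c (j + + 1)
  rel₁ = trans (paths-ratio n (j - + 1)) (cong (λ i → (+ n + (j - + 1) + + 2) · c i) (j-1+2≡j+1 j))

paths-quadratic : ∀ n → let c₀ = paths n 0ℤ; c₂ = paths n (+ 2); c₄ = paths n (+ 4) in
  c₀ · c₂ + + 2 · c₀ · c₄ - (+ 2 · c₂ · c₂ + c₂ · c₄) ≡ 0ℤ
paths-quadratic n = ℤₚ.*-cancelˡ-≡ (+ 4 + + n) _ 0ℤ (begin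
  (+ 4 + + n) · (c₀ · c₂ + + 2 · c₀ · c₄ - (+ 2 · c₂ · c₂ + c₂ · c₄))
    ≡⟨ combine (+ n) c₀ c₂ c₄ ⟩
  + 3 · c₂ · ((+ n - 0ℤ) · c₀ - (+ n + 0ℤ + + 2) · c₂) + (c₂ - + 2 · c₀) · ((+ n - + 2) · c₂ - (+ n + + 2 + + 2) · c₄)
    ≡⟨ cong₂ (λ u v → + 3 · c₂ · u + (c₂ - + 2 · c₀) · v)
             (ℤₚ.i≡j⇒i-j≡0 (paths-ratio n 0ℤ)) (ℤₚ.i≡j⇒i-j≡0 (paths-ratio n (+ 2))) ⟩
  + 3 · c₂ · 0ℤ + (c₂ - + 2 · c₀) · 0ℤ
    ≡⟨ annihilate (+ 3 · c₂) (c₂ - + 2 · c₀) ⟩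
  0ℤ
    ≡⟨ ℤₚ.*-zeroʳ (+ 4 + + n) ⟨
  (+ 4 + + n) · 0ℤ ∎)
  where
  open ≡-Reasoning
  c₀ : ℤ
  c₀ = paths n 0ℤ
  c₂ : ℤ
  c₂ = paths n (+ 2)
  c₄ : ℤ
  c₄ = paths n (+ 4)
  combine : ∀ m c₀ c₂ c₄ →
    (+ 4 + m) · (c₀ · c₂ + + 2 · c₀ · c₄ - (+ 2 · c₂ · c₂ + c₂ · c₄)) ≡
    + 3 · c₂ · ((m - 0ℤ) · c₀ - (m + 0ℤ + + 2) · c₂) + (c₂ - + 2 · c₀) · ((m - + 2) · c₂ - (m + + 2 + + 2) · c₄)
  combine = solve-∀
  annihilate : ∀ a b → a · 0ℤ + b · 0ℤ ≡ 0ℤ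
  annihilate = solve-∀

-- The reflection principle for Dyck paths

dyckCount-paths : ∀ n k → + dyckCount n (+ k) ≡ paths n (+ k) - paths n (+ k + + 2)
dyckCount-paths zero zero    = refl
dyckCount-paths zero (suc k) = refl
dyckCount-paths (suc n) k = begin
  + guard (0ℤ ≤? + k + + 1) (dyckCount n (+ k + + 1)) + + guard (0ℤ ≤? + k - + 1) (dyckCount n (+ k - + 1))
    ≡⟨ cong₂ _+_ up (down k) ⟩
  (c (+ k + + 1) - c (+ k + + 1 + + 2)) + (c (+ k - + 1) - c (+ k + + 1))
    ≡⟨ telescope (c (+ k - + 1)) (c (+ k + + 1)) (c (+ k + + 1 + + 2)) ⟩
  (c (+ k - + 1) + c (+ k + + 1)) - (c (+ k + + 1) + c (+ k + + 1 + + 2))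
    ≡⟨ cong₂ (λ u v → (c (+ k - + 1) + c (+ k + + 1)) - (c u + c v)) (k+2-1≡k+1 (+ k)) (k+2+1≡k+1+2 (+ k)) ⟨
  paths (suc n) (+ k) - paths (suc n) (+ k + + 2) ∎
  where
  open ≡-Reasoning
  c : ℤ → ℤ
  c = paths n
  k+2-1≡k+1 : ∀ k → k + + 2 - + 1 ≡ k + + 1
  k+2-1≡k+1 = solve-∀
  k+2+1≡k+1+2 : ∀ k → k + + 2 + + 1 ≡ k + + 1 + + 2
  k+2+1≡k+1+2 = solve-∀
  telescope : ∀ p q r → (q - r) + (p - q) ≡ (p + q) - (q + r)
  telescope = solve-∀
  up : + guard (0ℤ ≤? + k + + 1) (dyckCount n (+ k + + 1)) ≡ c (+ k + + 1) - c (+ k + + 1 + + 2)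
  up = +-guard-≡ (0ℤ ≤? + k + + 1) (λ _ → dyckCount-paths n (k ℕ.+ 1)) (λ 0≰ → contradiction (+≤+ z≤n) 0≰)
  down : ∀ k → + guard (0ℤ ≤? + k - + 1) (dyckCount n (+ k - + 1)) ≡ c (+ k - + 1) - c (+ k + + 1)
  down zero    = +-guard-≡ (0ℤ ≤? -[1+ 0 ]) {dyckCount n -[1+ 0 ]} (λ ())
                   (λ _ → trans (cong (_- c (+ 1)) (paths-reflect n (+ 1))) (ℤₚ.+-inverseʳ (c (+ 1))))
  down (suc k) = +-guard-≡ (0ℤ ≤? + k)
                   (λ _ → trans (dyckCount-paths n k) (cong (λ i → c (+ k) - c i) (cong +_ (ℕₚ.+-suc k 1))))
                   (λ 0≰ → contradiction (+≤+ z≤n) 0≰)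

dyckCount-2+ : ∀ n → + dyckCount (suc (suc n)) 0ℤ ≡ paths n 0ℤ - paths n (+ 4)
dyckCount-2+ n = begin
  + dyckCount (suc (suc n)) 0ℤ
    ≡⟨ dyckCount-paths (suc (suc n)) 0 ⟩
  (c (0ℤ - + 2) + c₀ + (c₀ + c₂)) - (c₀ + c₂ + (c₂ + c₄))
    ≡⟨ cong (λ u → (u + c₀ + (c₀ + c₂)) - (c₀ + c₂ + (c₂ + c₄))) (paths-reflect n (+ 2)) ⟩
  (c₂ + c₀ + (c₀ + c₂)) - (c₀ + c₂ + (c₂ + c₄))
    ≡⟨ cancel c₀ c₂ c₄ ⟩
  c₀ - c₄ ∎
  where
  open ≡-Reasoning
  c : ℤ → ℤ
  c = paths n
  c₀ : ℤ
  c₀ = c 0ℤ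
  c₂ : ℤ
  c₂ = c (+ 2)
  c₄ : ℤ
  c₄ = c (+ 4)
  cancel : ∀ a b d → (b + a + (a + b)) - (a + b + (b + d)) ≡ a - d
  cancel = solve-∀

-- The determinant formula for walks in the region

A B : ℕ → ℤ → ℤ
A n z = pathsTail n (+ 3 - z) - pathsTail n (z + + 3)
B n z = paths n (z - + 1) - paths n (z + + 1)

H : ℕ → ℤ → ℤ → ℤ
H = det A B

H-suc : ∀ n s t → H (suc n) s t ≡
  (H n (s - + 1) (t - + 1) + H n (s - + 1) (t + + 1)) + (H n (s + + 1) (t - + 1) + H n (s + + 1) (t + + 1))
H-suc = det-suc A-isPascal B-isPascal
  where
  A-isPascal : IsPascal A
  A-isPascal = IsPascal-− (IsPascal-reflect (pascal-isPascal evenNonpos) (+ 3))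
                          (IsPascal-shift (pascal-isPascal evenNonpos) (+ 3))
  B-isPascal : IsPascal B
  B-isPascal = IsPascal-− (IsPascal-shift (pascal-isPascal δ₀) (- + 1))
                          (IsPascal-shift (pascal-isPascal δ₀) (+ 1))

H-diagonal : ∀ n s → H n s s ≡ 0ℤ
H-diagonal n s = ℤₚ.+-inverseʳ (A n s · B n s)

H-zero : ∀ n s → H n s 0ℤ ≡ 0ℤ
H-zero n s = begin
  A n s · B n 0ℤ - A n 0ℤ · B n s ≡⟨ cong₂ (λ u v → A n s · u - v · B n s) B-zero A-zero ⟩
  A n s · 0ℤ - 0ℤ · B n s         ≡⟨ annihilate (A n s) (B n s) ⟩
  0ℤ                              ∎
  where
  open ≡-Reasoning
  A-zero : A n 0ℤ ≡ 0ℤ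
  A-zero = ℤₚ.+-inverseʳ (pathsTail n (+ 3))
  B-zero : B n 0ℤ ≡ 0ℤ
  B-zero = trans (cong (_- paths n (+ 1)) (paths-reflect n (+ 1))) (ℤₚ.+-inverseʳ (paths n (+ 1)))
  annihilate : ∀ a b → a · 0ℤ - 0ℤ · b ≡ 0ℤ
  annihilate = solve-∀

H-origin : ∀ n → H n (+ 3) (+ 1) ≡ (paths n 0ℤ - paths n (+ 2)) · (paths n 0ℤ - paths n (+ 4))
H-origin n = begin
  A n (+ 3) · (c₀ - c₂) - A n (+ 1) · (c₂ - c₄)
    ≡⟨ cong₂ (λ u v → u · (c₀ - c₂) - v · (c₂ - c₄)) A₃ A₁ ⟩
  (c₀ + c₂ + c₄) · (c₀ - c₂) - c₂ · (c₂ - c₄)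
    ≡⟨ rearrange c₀ c₂ c₄ ⟩
  (c₀ - c₂) · (c₀ - c₄) + (c₀ · c₂ + + 2 · c₀ · c₄ - (+ 2 · c₂ · c₂ + c₂ · c₄))
    ≡⟨ cong (_+_ ((c₀ - c₂) · (c₀ - c₄))) (paths-quadratic n) ⟩
  (c₀ - c₂) · (c₀ - c₄) + 0ℤ
    ≡⟨ ℤₚ.+-identityʳ _ ⟩
  (c₀ - c₂) · (c₀ - c₄) ∎
  where
  open ≡-Reasoning
  c₀ : ℤ
  c₀ = paths n 0ℤ
  c₂ : ℤ
  c₂ = paths n (+ 2)
  c₄ : ℤ
  c₄ = paths n (+ 4)
  τ : ℤ → ℤ
  τ = pathsTail n
  A₁ : A n (+ 1) ≡ c₂
  A₁ = trans (cong (_- τ (+ 4)) (pathsTail-unfold n (+ 2))) (cancel₁ c₂ (τ (+ 4)))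
    where cancel₁ : ∀ a t → (a + t) - t ≡ a
          cancel₁ = solve-∀
  A₃ : A n (+ 3) ≡ c₀ + c₂ + c₄
  A₃ = begin
    τ 0ℤ - τ (+ 6)
      ≡⟨ cong (_- τ (+ 6)) (trans (pathsTail-unfold n 0ℤ) (cong (_+_ c₀)
           (trans (pathsTail-unfold n (+ 2)) (cong (_+_ c₂) (pathsTail-unfold n (+ 4)))))) ⟩
    (c₀ + (c₂ + (c₄ + τ (+ 6)))) - τ (+ 6)
      ≡⟨ cancel₃ c₀ c₂ c₄ (τ (+ 6)) ⟩
    c₀ + c₂ + c₄ ∎
    where cancel₃ : ∀ a b c t → (a + (b + (c + t))) - t ≡ a + b + c
          cancel₃ = solve-∀
  rearrange : ∀ c₀ c₂ c₄ → (c₀ + c₂ + c₄) · (c₀ - c₂) - c₂ · (c₂ - c₄) ≡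
    (c₀ - c₂) · (c₀ - c₄) + (c₀ · c₂ + + 2 · c₀ · c₄ - (+ 2 · c₂ · c₂ + c₂ · c₄))
  rearrange = solve-∀

-- the walls y = x + 1 and y = −1 just outside the region are where θ = 0 and σ = θ
σ θ : Point → ℤ
σ (x , y) = x + y + + 3
θ (x , y) = x - y + + 1

Φ : ℕ → Point → ℤ
Φ n p = H n (σ p) (θ p)

Δσ Δθ : Step → ℤ
Δσ N = + 1
Δσ S = - + 1
Δσ E = + 1
Δσ W = - + 1
Δθ N = - + 1
Δθ S = + 1
Δθ E = + 1
Δθ W = - + 1

Φ-move : ∀ n p s → Φ n (move p s) ≡ H n (σ p + Δσ s) (θ p + Δθ s)
Φ-move n (x , y) s = cong₂ (H n) (σ-move s) (θ-move s)
  where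
  vertical : ∀ x y d → x + (y + d) + + 3 ≡ x + y + + 3 + d
  vertical = solve-∀
  horizontal : ∀ x y d → x + d + y + + 3 ≡ x + y + + 3 + d
  horizontal = solve-∀
  vertical′ : ∀ x y d → x - (y + d) + + 1 ≡ x - y + + 1 - d
  vertical′ = solve-∀
  horizontal′ : ∀ x y d → x + d - y + + 1 ≡ x - y + + 1 + d
  horizontal′ = solve-∀
  σ-move : ∀ s → σ (move (x , y) s) ≡ σ (x , y) + Δσ s
  σ-move N = vertical x y (+ 1)
  σ-move S = vertical x y (- + 1)
  σ-move E = horizontal x y (+ 1)
  σ-move W = horizontal x y (- + 1)
  θ-move : ∀ s → θ (move (x , y) s) ≡ θ (x , y) + Δθ s
  θ-move N = vertical′ x y (+ 1)
  θ-move S = vertical′ x y (- + 1)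
  θ-move E = horizontal′ x y (+ 1)
  θ-move W = horizontal′ x y (- + 1)

Φ-suc : ∀ n p → Φ (suc n) p ≡ Φ n (move p N) + (Φ n (move p S) + (Φ n (move p E) + Φ n (move p W)))
Φ-suc n p = begin
  H (suc n) s t
    ≡⟨ H-suc n s t ⟩
  (H n (s - + 1) (t - + 1) + H n (s - + 1) (t + + 1)) + (H n (s + + 1) (t - + 1) + H n (s + + 1) (t + + 1))
    ≡⟨ regroup (H n (s - + 1) (t - + 1)) (H n (s - + 1) (t + + 1)) (H n (s + + 1) (t - + 1)) (H n (s + + 1) (t + + 1)) ⟩
  H n (s + + 1) (t - + 1) + (H n (s - + 1) (t + + 1) + (H n (s + + 1) (t + + 1) + H n (s - + 1) (t - + 1)))
    ≡⟨ cong₂ _+_ (Φ-move n p N) (cong₂ _+_ (Φ-move n p S) (cong₂ _+_ (Φ-move n p E) (Φ-move n p W))) ⟨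
  Φ n (move p N) + (Φ n (move p S) + (Φ n (move p E) + Φ n (move p W))) ∎
  where
  open ≡-Reasoning
  s : ℤ
  s = σ p
  t : ℤ
  t = θ p
  regroup : ∀ a b c d → (a + b) + (c + d) ≡ c + (b + (d + a))
  regroup = solve-∀

exit : ∀ {p} s → InRegion p → ¬ InRegion (move p s) →
       (∃[ x ] move p s ≡ (x , x + + 1)) ⊎ (∃[ x ] move p s ≡ (x , - + 1))
exit {+ j , + k} N (+≤+ k≤j , _) out = inj₁ (+ j , cong (λ i → + j , + (i ℕ.+ 1)) k≡j)
  where k≡j : k ≡ j
        k≡j = ℕₚ.≤∧≮⇒≡ k≤j (λ k<j → out (+≤+ (subst (ℕ._≤ j) (ℕₚ.+-comm 1 k) k<j) , +≤+ z≤n))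
exit {+ j , + zero}  S _              _   = inj₂ (+ j , refl)
exit {+ j , + suc k} S (+≤+ k<j , _)  out = ⊥-elim (out (+≤+ (ℕₚ.<⇒≤ k<j) , +≤+ z≤n))
exit {+ j , + k}     E (+≤+ k≤j , _)  out = ⊥-elim (out (+≤+ (ℕₚ.m≤n⇒m≤n+o 1 k≤j) , +≤+ z≤n))
exit {+ zero  , + zero} W _           _   = inj₁ (- + 1 , refl)
exit {+ zero  , + suc _} W (+≤+ () , _) _
exit {+ suc j , + k}    W (+≤+ k≤j , _) out = inj₁ (+ j , cong (λ i → + j , + i) k≡j+1)
  where k≡j+1 : k ≡ j ℕ.+ 1
        k≡j+1 = trans (ℕₚ.≤-antisym k≤j (ℕₚ.≰⇒> (λ k≤j′ → out (+≤+ k≤j′ , +≤+ z≤n)))) (ℕₚ.+-comm 1 j)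
exit {_ , -[1+ _ ]} _ (_ , ()) _
exit { -[1+ _ ] , + _ } _ (() , _) _

Φ-wall : ∀ n {p} s → InRegion p → ¬ InRegion (move p s) → Φ n (move p s) ≡ 0ℤ
Φ-wall n s p∈ out with exit s p∈ out
... | inj₁ (x , eq) =
  trans (cong (Φ n) eq) (trans (cong (H n (σ (x , x + + 1))) (θ≡0 x)) (H-zero n (σ (x , x + + 1))))
  where θ≡0 : ∀ x → x - (x + + 1) + + 1 ≡ 0ℤ
        θ≡0 = solve-∀
... | inj₂ (x , eq) =
  trans (cong (Φ n) eq) (trans (cong (λ u → H n u (θ (x , - + 1))) (σ≡θ x)) (H-diagonal n (θ (x , - + 1))))
  where σ≡θ : ∀ x → x + - + 1 + + 3 ≡ x - - + 1 + + 1
        σ≡θ = solve-∀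

H₀-at-1 : ∀ m → H 0 (+ (3 ℕ.+ m)) (+ 1) ≡ evenNonpos (- + m)
H₀-at-1 m = begin
  A 0 s · + 1 - A 0 (+ 1) · 0ℤ   ≡⟨ first (A 0 s) (A 0 (+ 1)) ⟩
  evenNonpos (+ 3 - s) - 0ℤ      ≡⟨ ℤₚ.+-identityʳ (evenNonpos (+ 3 - s)) ⟩
  evenNonpos (+ 3 - (+ 3 + + m)) ≡⟨ cong evenNonpos (3-[3+m]≡-m (+ m)) ⟩
  evenNonpos (- + m)             ∎
  where
  open ≡-Reasoning
  s : ℤ
  s = + (3 ℕ.+ m)
  first : ∀ a b → a · + 1 - b · 0ℤ ≡ a
  first = solve-∀
  3-[3+m]≡-m : ∀ m → + 3 - (+ 3 + m) ≡ - m
  3-[3+m]≡-m = solve-∀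

H₀-above-1 : ∀ m e → H 0 (+ (3 ℕ.+ m)) (+ (2 ℕ.+ e)) ≡ 0ℤ
H₀-above-1 m e = annihilate (A 0 (+ (3 ℕ.+ m))) (A 0 (+ (2 ℕ.+ e)))
  where annihilate : ∀ a b → a · 0ℤ - b · 0ℤ ≡ 0ℤ
        annihilate = solve-∀

Φ-initial : ∀ p → InRegion p → + walkCount 0 p ≡ Φ 0 p
Φ-initial (+ j , + k) (+≤+ k≤j , _) with j ∸ k | ℕₚ.m∸n+n≡m k≤j
... | zero  | refl = +-guard-≡ (+ k ≟ + k) (λ _ → sym diagonal) (λ k≢k → contradiction refl k≢k)
  where
  open ≡-Reasoning
  x-x+1≡1 : ∀ x → x - x + + 1 ≡ + 1
  x-x+1≡1 = solve-∀
  diagonal : Φ 0 (+ k , + k) ≡ + 1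
  diagonal = begin
    H 0 (+ (k ℕ.+ k ℕ.+ 3)) (+ k - + k + + 1)
      ≡⟨ cong₂ (H 0) (cong +_ (ℕₚ.+-comm (k ℕ.+ k) 3)) (x-x+1≡1 (+ k)) ⟩
    H 0 (+ (3 ℕ.+ (k ℕ.+ k))) (+ 1) ≡⟨ H₀-at-1 (k ℕ.+ k) ⟩
    evenNonpos (- + (k ℕ.+ k))      ≡⟨ evenNonpos-double k ⟩
    + 1                             ∎
... | suc e | refl = +-guard-≡ (+ k ≟ + (suc e ℕ.+ k))
                       (λ k≡j → contradiction (ℤₚ.+-injective k≡j) (ℕₚ.m≢1+n+m k))
                       (λ _ → off-diagonal)
  where
  θ≡2+e : ∀ e k → + 1 + e + k - k + + 1 ≡ + 2 + e
  θ≡2+e = solve-∀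
  off-diagonal : Φ 0 (+ (suc e ℕ.+ k) , + k) ≡ 0ℤ
  off-diagonal = trans (cong₂ (H 0) (cong +_ (ℕₚ.+-comm (suc e ℕ.+ k ℕ.+ k) 3)) (θ≡2+e (+ e) (+ k)))
                       (H₀-above-1 (suc e ℕ.+ k ℕ.+ k) e)
Φ-initial (_ , -[1+ _ ]) (_ , ())
Φ-initial (-[1+ _ ] , + _) (() , _)

walkCount≡Φ : ∀ n p → InRegion p → + walkCount n p ≡ Φ n p
walkCount≡Φ zero    p p∈ = Φ-initial p p∈
walkCount≡Φ (suc n) p p∈ = begin
  + walkCount (suc n) p
    ≡⟨ cong₂ _+_ (via N) (cong₂ _+_ (via S) (cong₂ _+_ (via E) (via W))) ⟩
  Φ n (move p N) + (Φ n (move p S) + (Φ n (move p E) + Φ n (move p W)))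
    ≡⟨ Φ-suc n p ⟨
  Φ (suc n) p ∎
  where open ≡-Reasoning
        via : ∀ s → + guard (region? (move p s)) (walkCount n (move p s)) ≡ Φ n (move p s)
        via s = +-guard-≡ (region? (move p s)) (walkCount≡Φ n (move p s)) (Φ-wall n s p∈)

walkCount-origin : ∀ n → walkCount n origin ≡ dyckCount n 0ℤ * dyckCount (suc (suc n)) 0ℤ
walkCount-origin n = ℤₚ.+-injective (begin
  + walkCount n origin
    ≡⟨ walkCount≡Φ n origin (ℤₚ.≤-refl , ℤₚ.≤-refl) ⟩
  H n (+ 3) (+ 1)
    ≡⟨ H-origin n ⟩
  (paths n 0ℤ - paths n (+ 2)) · (paths n 0ℤ - paths n (+ 4))
    ≡⟨ cong₂ _·_ (dyckCount-paths n 0) (dyckCount-2+ n) ⟨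
  + dyckCount n 0ℤ · + dyckCount (suc (suc n)) 0ℤ
    ≡⟨ ℤₚ.pos-* (dyckCount n 0ℤ) (dyckCount (suc (suc n)) 0ℤ) ⟨
  + (dyckCount n 0ℤ * dyckCount (suc (suc n)) 0ℤ) ∎)
  where open ≡-Reasoning

corollary4p1 : (m : ℕ) → 𝒪 (2 * m) ⤖ (𝒟 (2 * m) × 𝒟 (2 * suc m))
corollary4p1 m = ↔⇒⤖ (begin
  𝒪 (2 * m)
    ↔⟨ Walk↔Fin (2 * m) origin ⟩
  Fin (walkCount (2 * m) origin)
    ≡⟨ cong Fin (walkCount-origin (2 * m)) ⟩
  Fin (dyckCount (2 * m) 0ℤ * dyckCount (suc (suc (2 * m))) 0ℤ)
    ≡⟨ cong (λ k → Fin (dyckCount (2 * m) 0ℤ * dyckCount k 0ℤ)) (ℕₚ.*-suc 2 m) ⟨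
  Fin (dyckCount (2 * m) 0ℤ * dyckCount (2 * suc m) 0ℤ)
    ↔⟨ *↔× ⟩
  (Fin (dyckCount (2 * m) 0ℤ) × Fin (dyckCount (2 * suc m) 0ℤ))
    ↔⟨ Dyck↔Fin (2 * m) 0ℤ ×-↔ Dyck↔Fin (2 * suc m) 0ℤ ⟨
  (𝒟 (2 * m) × 𝒟 (2 * suc m)) ∎)
  where open EquationalReasoning
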